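{- If the poset $\mathbf 2$ with exactly two elements $0\sqsubseteq 1$ is $\delta_{\mathcal V}$-complete, then weak excluded middle in $\mathcal V$ holds, i.e. $\neg P+\neg\neg P$ for every proposition $P:\mathcal V$.
   Context: Setting: intensional Martin-Löf type theory with type universes, function extensionality, propositional extensionality and propositional truncations; no excluded middle assumed. A proposition is a type any two of whose elements are equal. A poset $X$ (type with proposition-valued reflexive, transitive, antisymmetric relation $\sqsubseteq$) is $\delta_{\mathcal V}$-complete if for all $x\sqsubseteq y$ and every proposition $P:\mathcal V$ the family $\delta_{x,y,P}:\mathbf 1+P\to X$, $\mathrm{inl}(\star)\mapsto x$, $\mathrm{inr}(p)\mapsto y$, has a least upper bound in $X$. -}

module Defs where

open import Level using (Level; _⊔_)
open import Data.Unit using (⊤; tt)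
open import Data.Sum using (_⊎_; inj₁; inj₂)
open import Data.Product using (Σ; _×_)
open import Data.Bool using (Bool; true; false)
import Data.Bool as B
open import Relation.Binary.PropositionalEquality using (_≡_)
open import Relation.Nullary using (¬_)

isProp : ∀ {ℓ} → Set ℓ → Set ℓ
isProp A = (a b : A) → a ≡ b

isUpperBound : ∀ {u v w} {X : Set u} (_⊑_ : X → X → Set v) {I : Set w}
             → (I → X) → X → Set (v ⊔ w)
isUpperBound _⊑_ α x = ∀ i → α i ⊑ x

isLUB : ∀ {u v w} {X : Set u} (_⊑_ : X → X → Set v) {I : Set w}
      → (I → X) → X → Set (u ⊔ v ⊔ w)
isLUB {X = X} _⊑_ α x = isUpperBound {X = X} _⊑_ α x × (∀ y → isUpperBound {X = X} _⊑_ α y → x ⊑ y)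

hasSup : ∀ {u v w} {X : Set u} (_⊑_ : X → X → Set v) {I : Set w}
       → (I → X) → Set (u ⊔ v ⊔ w)
hasSup {X = X} _⊑_ α = Σ X (isLUB _⊑_ α)

δ : ∀ {u ℓ} {X : Set u} → X → X → (P : Set ℓ) → ⊤ ⊎ P → X
δ x y P (inj₁ _) = x
δ x y P (inj₂ _) = y

isδComplete : ∀ {u v} (ℓ : Level) {X : Set u} (_⊑_ : X → X → Set v)
            → Set (u ⊔ v ⊔ Level.suc ℓ)
isδComplete ℓ {X} _⊑_ =
  (x y : X) → x ⊑ y → (P : Set ℓ) → isProp P → hasSup _⊑_ (δ x y P)

-- The two-element poset 𝟚 : false ⊑ true (0 ⊑ 1), using Data.Bool's _≤_.
𝟚 : Set
𝟚 = Bool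

_⊑𝟚_ : 𝟚 → 𝟚 → Set
_⊑𝟚_ = B._≤_

WEM : (ℓ : Level) → Set (Level.suc ℓ)
WEM ℓ = (P : Set ℓ) → isProp P → (¬ P) ⊎ (¬ ¬ P)

{-# OPTIONS --safe #-}
-- The supremum s of δ_{0,1,P} decides weak excluded middle: if s = 0, no p : P
-- can exist since 1 ⊑ s; if s = 1, then ¬P is impossible since ¬P makes 0 an
-- upper bound and hence 1 ⊑ 0. As 𝟚 has just these two elements, we get ¬P + ¬¬P.
module Submission where

open import Defs
open import Level using (Level)
open import Data.Bool using (true; false)
open import Data.Bool.Base using (b≤b; f≤t)
open import Data.Sum using (_⊎_; inj₁; inj₂)
open import Data.Product using (_,_; proj₁; proj₂)
open import Data.Empty using (⊥-elim)
open import Function using (_∘′_)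
open import Relation.Nullary using (¬_)

module _ {u v ℓ} {X : Set u} (_⊑_ : X → X → Set v) {x y s : X} {P : Set ℓ}
         (refl-x : x ⊑ x) (s-lub : isLUB _⊑_ (δ x y P) s) where

  δ-lub-above-top : P → y ⊑ s
  δ-lub-above-top p = proj₁ s-lub (inj₂ p)

  δ-lub-below-bottom : ¬ P → s ⊑ x
  δ-lub-below-bottom ¬p = proj₂ s-lub x bound
    where
    bound : isUpperBound _⊑_ (δ x y P) x
    bound (inj₁ _) = refl-x
    bound (inj₂ p) = ⊥-elim (¬p p)

¬true⊑false : ¬ (true ⊑𝟚 false)
¬true⊑false ()

mainTheorem4 : (ℓ : Level) → isδComplete ℓ _⊑𝟚_ → WEM ℓ
mainTheorem4 ℓ complete P P-prop with complete false true f≤t P P-prop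
... | false , s-lub = inj₁ (¬true⊑false ∘′ δ-lub-above-top _⊑𝟚_ b≤b s-lub)
... | true  , s-lub = inj₂ (¬true⊑false ∘′ δ-lub-below-bottom _⊑𝟚_ b≤b s-lub)
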